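{- If $\mathcal A$ is a $k$-wise eventown on $[n]$, then $\mathcal A$ contains a subfamily $\mathcal A'$ with $|\mathcal A'|\ge|\mathcal A|-(k-1)n$ which is a strong $k$-wise eventown.
   Context: A family $\{A_1,\ldots,A_m\}$ of distinct subsets of $[n]$ is a $k$-wise eventown if $|\bigcap_{i\in S}A_i|$ is even for every $S\subseteq[m]$ with $|S|=k$, and a strong $k$-wise eventown if it is a $k'$-wise eventown for every $k'\in\{1,\ldots,k\}$. -}

module Defs where

open import Data.Nat using (ℕ; zero; suc)
open import Data.Nat.Divisibility using (_∣_)
open import Data.Bool using (Bool; true; false; _∧_; _∨_; not)
open import Data.Fin using (Fin; zero; suc)
open import Data.Fin.Subset using (Subset; _∈_; _⊆_; ∣_∣)
open import Data.Vec using (lookup; tabulate)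

allB : ∀ {m} → (Fin m → Bool) → Bool
allB {zero}  f = true
allB {suc m} f = f zero ∧ allB (λ i → f (suc i))

-- ⋂_{i ∈ S} A_i  as a subset of [n]  (indices i ∈ S ⊆ [m])
⋂[_]_ : ∀ {m n} → (Fin m → Subset n) → Subset m → Subset n
⋂[ A ] S = tabulate λ j → allB λ i → not (lookup S i) ∨ lookup (A i) j

-- A family (indexed by Fin m, distinctness imposed separately) is a
-- k-wise eventown: |⋂_{i∈S} A_i| is even for every S ⊆ [m] with |S| = k.
KWiseEventown : ∀ {m n} → ℕ → (Fin m → Subset n) → Set
KWiseEventown k A = ∀ S → ∣ S ∣ ≡ k → 2 ∣ ∣ ⋂[ A ] S ∣
  where open import Relation.Binary.PropositionalEquality using (_≡_)

KWiseEventownOn : ∀ {m n} → ℕ → (Fin m → Subset n) → Subset m → Set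
KWiseEventownOn k A T = ∀ S → S ⊆ T → ∣ S ∣ ≡ k → 2 ∣ ∣ ⋂[ A ] S ∣
  where open import Relation.Binary.PropositionalEquality using (_≡_)

StrongKWiseEventownOn : ∀ {m n} → ℕ → (Fin m → Subset n) → Subset m → Set
StrongKWiseEventownOn k A T = ∀ k′ → 1 ≤ k′ → k′ ≤ k → KWiseEventownOn k′ A T
  where open import Data.Nat using (_≤_)

module Submission where

-- Over GF(2) the parity of |A ∩ B| is the inner product A · B.  If {A_i : i ∈ T} is a
-- (j+1)-wise eventown, repeatedly delete from T an index x of some j-set S ⊆ T with
-- |⋂_S A| odd, recording the pair (A_x, ⋂_S A).  Then A_x · ⋂_S A = 1, whereas
-- A_x · ⋂_S′ A = |⋂_{S′ ∪ {x}} A| = 0 (mod 2) for every j-set S′ of the indices that remain.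
-- So the recorded pairs form a triangular system in GF(2)^n, hence there are at most n of
-- them, and what is left when the process stops is a j-wise (and still a (j+1)-wise)
-- eventown.  Running this for j = k − 1, …, 1 deletes at most (k − 1) n indices.

open import Defs
open import Data.Nat using (ℕ; _+_; _*_; _∸_; _≤_)
open import Data.Fin using (Fin)
open import Data.Fin.Subset using (Subset; ∣_∣)
open import Data.Product using (Σ; _×_)
open import Function.Definitions using (Injective)
open import Relation.Binary.PropositionalEquality using (_≡_)

open import Algebra.Bundles using (CommutativeRing)
open import Data.Bool using (Bool; true; false; not; _∧_; _∨_; _xor_; if_then_else_)
open import Data.Bool.Properties
  using (xor-∧-commutativeRing; ∧-distribˡ-xor; ∧-zeroʳ; ∨-zeroʳ; xor-identityʳ; not-involutive)
open import Data.Fin using (zero; suc)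
open import Data.Fin.Subset using (⊤; inside; outside; _∈_; _∉_; _⊆_; _∪_; _∩_; _-_; ⁅_⁆; Nonempty)
open import Data.Fin.Subset.Properties
  using (∪-identityˡ; p─⊥≡p; p─q⊆p; x∈p∪q⁻; x∈⁅y⁆⇒x≡y; x∈p⇒∣p-x∣<∣p∣; ∣⊤∣≡n; _⊆?_; anySubset?)
open import Data.List using (List; []; _∷_; length; map)
open import Data.List.Properties using (length-map)
open import Data.List.Relation.Unary.All as All using (All; []; _∷_)
open import Data.List.Relation.Unary.All.Properties using (map⁺)
open import Data.Nat using (zero; suc; _<_; _≟_; s≤s; z≤n)
open import Data.Nat.Divisibility using (_∣_; _∣?_; divides; ∣-refl; ∣m∣n⇒∣m+n; ∣m+n∣m⇒∣n; ∣1⇒≡1)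
open import Data.Nat.Induction using (<-wellFounded)
open import Data.Nat.Properties
  using (+-assoc; +-comm; +-suc; +-identityʳ; +-monoˡ-≤; +-monoʳ-≤; m≤m+n; ≤-pred; m≤n⇒m<n∨m≡n;
         module ≤-Reasoning)
open import Data.Product using (∃; _,_)
open import Data.Sum using (inj₁; inj₂)
open import Data.Vec using (Vec; []; _∷_; here; there; lookup; removeAt; zipWith)
open import Data.Vec.Properties
  using (lookup-zipWith; lookup∘tabulate; tabulate∘lookup; tabulate-cong)
open import Function using (_∘_; id)
open import Induction.WellFounded using (Acc; acc)
open import Relation.Binary.PropositionalEquality
  using (refl; sym; trans; cong; cong₂; subst; module ≡-Reasoning)
open import Relation.Nullary using (¬_; ¬?; Dec; yes; no; contradiction)
open import Relation.Nullary.Decidable using (_×-dec_; decidable-stable)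

open import Algebra.Properties.CommutativeSemigroup
  (CommutativeRing.+-commutativeSemigroup xor-∧-commutativeRing) using (interchange)
import Algebra.Properties.CommutativeSemigroup
  (CommutativeRing.*-commutativeSemigroup xor-∧-commutativeRing) as ∧

odd : ℕ → Bool
odd zero    = false
odd (suc k) = not (odd k)

odd≡false⇒2∣ : ∀ k → odd k ≡ false → 2 ∣ k
odd≡false⇒2∣ zero          _ = divides 0 refl
odd≡false⇒2∣ (suc zero)    ()
odd≡false⇒2∣ (suc (suc k)) e =
  ∣m∣n⇒∣m+n (∣-refl {2}) (odd≡false⇒2∣ k (trans (sym (not-involutive (odd k))) e))

2∣⇒odd≡false : ∀ k → 2 ∣ k → odd k ≡ false
2∣⇒odd≡false zero          _   = refl
2∣⇒odd≡false (suc zero)    2∣1 with () ← ∣1⇒≡1 2∣1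
2∣⇒odd≡false (suc (suc k)) 2∣k+2 =
  trans (not-involutive (odd k)) (2∣⇒odd≡false k (∣m+n∣m⇒∣n 2∣k+2 (∣-refl {2})))

¬2∣⇒odd≡true : ∀ k → ¬ 2 ∣ k → odd k ≡ true
¬2∣⇒odd≡true k ¬2∣k with odd k in eq
... | true  = refl
... | false = contradiction (odd≡false⇒2∣ k eq) ¬2∣k

parity : ∀ {n} → Vec Bool n → Bool
parity []       = false
parity (x ∷ xs) = x xor parity xs

parity≡odd∣∣ : ∀ {n} (p : Subset n) → parity p ≡ odd ∣ p ∣
parity≡odd∣∣ []          = refl
parity≡odd∣∣ (true  ∷ p) = cong not (parity≡odd∣∣ p)
parity≡odd∣∣ (false ∷ p) = parity≡odd∣∣ p

infixl 7 _·_
infixl 6 _⊕_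

_·_ : ∀ {n} → Vec Bool n → Vec Bool n → Bool
u · v = parity (zipWith _∧_ u v)

_⊕_ : ∀ {n} → Vec Bool n → Vec Bool n → Vec Bool n
_⊕_ = zipWith _xor_

·-distribˡ-⊕ : ∀ {n} (u v w : Vec Bool n) → u · (v ⊕ w) ≡ (u · v) xor (u · w)
·-distribˡ-⊕ []      []      []      = refl
·-distribˡ-⊕ (x ∷ u) (y ∷ v) (z ∷ w) = begin
  (x ∧ (y xor z)) xor (u · (v ⊕ w))
    ≡⟨ cong₂ _xor_ (∧-distribˡ-xor x y z) (·-distribˡ-⊕ u v w) ⟩
  ((x ∧ y) xor (x ∧ z)) xor ((u · v) xor (u · w))
    ≡⟨ interchange (x ∧ y) (x ∧ z) (u · v) (u · w) ⟩
  ((x ∧ y) xor (u · v)) xor ((x ∧ z) xor (u · w))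
    ∎
  where open ≡-Reasoning

·-removeAt : ∀ {n} (u v : Vec Bool (suc n)) c → lookup v c ≡ false →
             removeAt u c · removeAt v c ≡ u · v
·-removeAt (x ∷ u)         (false ∷ v)       zero    refl = cong (_xor (u · v)) (sym (∧-zeroʳ x))
·-removeAt (x ∷ u@(_ ∷ _)) (y ∷ v@(_ ∷ _)) (suc c) vc≡0 =
  cong ((x ∧ y) xor_) (·-removeAt u v c vc≡0)

·≡true⇒pivot : ∀ {n} (u v : Vec Bool n) → u · v ≡ true → ∃ λ c → lookup v c ≡ true
·≡true⇒pivot []          []          ()
·≡true⇒pivot (x ∷ u)     (true  ∷ v) _ = zero , refl
·≡true⇒pivot (false ∷ u) (false ∷ v) e with c , vc≡1 ← ·≡true⇒pivot u v e = suc c , vc≡1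
·≡true⇒pivot (true ∷ u)  (false ∷ v) e with c , vc≡1 ← ·≡true⇒pivot u v e = suc c , vc≡1

infix 4 _⟂_

_⟂_ : ∀ {n} → Vec Bool n × Vec Bool n → Vec Bool n → Set
(a , _) ⟂ v = a · v ≡ false

-- The matrix (aᵢ · bⱼ) of a triangular list is unitriangular.
data Triangular {n} : List (Vec Bool n × Vec Bool n) → Set where
  []     : Triangular []
  extend : ∀ {a b L} → a · b ≡ true → All (_⟂ b) L → Triangular L → Triangular ((a , b) ∷ L)

-- Gaussian elimination at a pivot c of b: adding b to the remaining b′ clears their
-- coordinate c without changing any a′ · b′ (as a′ · b = 0), so c can then be dropped.
module Elimination {n} (b : Vec Bool (suc n)) (c : Fin (suc n)) (bc≡1 : lookup b c ≡ true) where

  clear : Vec Bool (suc n) → Vec Bool (suc n)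
  clear v = if lookup v c then v ⊕ b else v

  lookup-clear : ∀ v → lookup (clear v) c ≡ false
  lookup-clear v with lookup v c in vc
  ... | false = vc
  ... | true  = trans (lookup-zipWith _xor_ c v b) (cong₂ _xor_ vc bc≡1)

  ·-clear : ∀ a v → a · b ≡ false → a · clear v ≡ a · v
  ·-clear a v a·b≡0 with lookup v c
  ... | false = refl
  ... | true  = trans (·-distribˡ-⊕ a v b)
                      (trans (cong ((a · v) xor_) a·b≡0) (xor-identityʳ (a · v)))

  project : Vec Bool (suc n) × Vec Bool (suc n) → Vec Bool n × Vec Bool n
  project (a , v) = removeAt a c , removeAt (clear v) c

  project-· : ∀ a v → a · b ≡ false → removeAt a c · removeAt (clear v) c ≡ a · v
  project-· a v a·b≡0 = trans (·-removeAt a (clear v) c (lookup-clear v)) (·-clear a v a·b≡0)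

  project-⟂ : ∀ {p v} → p ⟂ v × p ⟂ b → project p ⟂ removeAt (clear v) c
  project-⟂ {a , _} {v} (a·v≡0 , a·b≡0) = trans (project-· a v a·b≡0) a·v≡0

  project-triangular : ∀ {L} → Triangular L → All (_⟂ b) L → Triangular (map project L)
  project-triangular []                             []             = []
  project-triangular (extend {a} {v} a·v≡1 L⟂v tri) (a·b≡0 ∷ L⟂b) =
    extend (trans (project-· a v a·b≡0) a·v≡1)
           (map⁺ (All.zipWith (λ {p} → project-⟂ {p} {v}) (L⟂v , L⟂b)))
           (project-triangular tri L⟂b)

triangular-length≤ : ∀ {n} {L : List (Vec Bool n × Vec Bool n)} → Triangular L → length L ≤ n
triangular-length≤                  []                         = z≤n
triangular-length≤ {n = zero}       (extend {[]} {[]} () _ _)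
triangular-length≤ {n = suc n} {L = (a , b) ∷ L} (extend a·b≡1 L⟂b tri)
  with c , bc≡1 ← ·≡true⇒pivot a b a·b≡1 =
  s≤s (subst (_≤ n) (length-map project L) (triangular-length≤ (project-triangular tri L⟂b)))
  where open Elimination b c bc≡1

nonempty-if-∣p∣≡suc : ∀ {n k} (p : Subset n) → ∣ p ∣ ≡ suc k → Nonempty p
nonempty-if-∣p∣≡suc (inside  ∷ p) _ = zero , here
nonempty-if-∣p∣≡suc (outside ∷ p) e with x , x∈p ← nonempty-if-∣p∣≡suc p e = suc x , there x∈p

x∈p⇒⁅x⁆∪p≡p : ∀ {n} {x : Fin n} {p} → x ∈ p → ⁅ x ⁆ ∪ p ≡ p
x∈p⇒⁅x⁆∪p≡p {p = _ ∷ p} here        = cong (inside ∷_) (∪-identityˡ p)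
x∈p⇒⁅x⁆∪p≡p {p = s ∷ _} (there x∈p) = cong (s ∷_) (x∈p⇒⁅x⁆∪p≡p x∈p)

x∉p⇒∣⁅x⁆∪p∣≡1+∣p∣ : ∀ {n} (x : Fin n) p → x ∉ p → ∣ ⁅ x ⁆ ∪ p ∣ ≡ suc ∣ p ∣
x∉p⇒∣⁅x⁆∪p∣≡1+∣p∣ zero    (outside ∷ p) _   = cong (suc ∘ ∣_∣) (∪-identityˡ p)
x∉p⇒∣⁅x⁆∪p∣≡1+∣p∣ zero    (inside  ∷ p) x∉p = contradiction here x∉p
x∉p⇒∣⁅x⁆∪p∣≡1+∣p∣ (suc x) (outside ∷ p) x∉p = x∉p⇒∣⁅x⁆∪p∣≡1+∣p∣ x p (x∉p ∘ there)
x∉p⇒∣⁅x⁆∪p∣≡1+∣p∣ (suc x) (inside  ∷ p) x∉p = cong suc (x∉p⇒∣⁅x⁆∪p∣≡1+∣p∣ x p (x∉p ∘ there))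

x∈p⇒∣p∣≡1+∣p-x∣ : ∀ {n} {x : Fin n} {p} → x ∈ p → ∣ p ∣ ≡ suc ∣ p - x ∣
x∈p⇒∣p∣≡1+∣p-x∣ {p = _       ∷ p} here        = cong (suc ∘ ∣_∣) (sym (p─⊥≡p p))
x∈p⇒∣p∣≡1+∣p-x∣ {p = outside ∷ _} (there x∈p) = x∈p⇒∣p∣≡1+∣p-x∣ x∈p
x∈p⇒∣p∣≡1+∣p-x∣ {p = inside  ∷ _} (there x∈p) = cong suc (x∈p⇒∣p∣≡1+∣p-x∣ x∈p)

x∉p-x : ∀ {n} (x : Fin n) p → x ∉ p - x
x∉p-x zero    (_ ∷ p) ()
x∉p-x (suc x) (_ ∷ p) (there x∈p-x) = x∉p-x x p x∈p-x

⁅x⁆∪p⊆q : ∀ {n} {x : Fin n} {p q} → x ∈ q → p ⊆ q → ⁅ x ⁆ ∪ p ⊆ q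
⁅x⁆∪p⊆q {x = x} {p} {q} x∈q p⊆q y∈⁅x⁆∪p with x∈p∪q⁻ ⁅ x ⁆ p y∈⁅x⁆∪p
... | inj₁ y∈⁅x⁆ = subst (_∈ q) (sym (x∈⁅y⁆⇒x≡y x y∈⁅x⁆)) x∈q
... | inj₂ y∈p   = p⊆q y∈p

allB-⁅x⁆∪ : ∀ {m} (S : Subset m) x (h : Fin m → Bool) →
            allB (λ i → not (lookup (⁅ x ⁆ ∪ S) i) ∨ h i) ≡
            h x ∧ allB (λ i → not (lookup S i) ∨ h i)
allB-⁅x⁆∪ (s ∷ S) zero h rewrite ∪-identityˡ S with h zero
... | false = refl
... | true  = cong (_∧ _) (sym (∨-zeroʳ (not s)))
allB-⁅x⁆∪ (s ∷ S) (suc x) h =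
  trans (cong ((not s ∨ h zero) ∧_) (allB-⁅x⁆∪ S x (h ∘ suc)))
        (∧.x∙yz≈y∙xz (not s ∨ h zero) (h (suc x)) _)

⋂-⁅x⁆∪ : ∀ {m n} (A : Fin m → Subset n) x S → ⋂[ A ] (⁅ x ⁆ ∪ S) ≡ A x ∩ ⋂[ A ] S
⋂-⁅x⁆∪ A x S = trans (tabulate-cong pointwise) (tabulate∘lookup (A x ∩ ⋂[ A ] S))
  where
  open ≡-Reasoning
  pointwise : ∀ j → allB (λ i → not (lookup (⁅ x ⁆ ∪ S) i) ∨ lookup (A i) j) ≡
                    lookup (A x ∩ ⋂[ A ] S) j
  pointwise j = begin
    allB (λ i → not (lookup (⁅ x ⁆ ∪ S) i) ∨ lookup (A i) j)
      ≡⟨ allB-⁅x⁆∪ S x (λ i → lookup (A i) j) ⟩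
    lookup (A x) j ∧ allB (λ i → not (lookup S i) ∨ lookup (A i) j)
      ≡⟨ cong (lookup (A x) j ∧_) (lookup∘tabulate _ j) ⟨
    lookup (A x) j ∧ lookup (⋂[ A ] S) j
      ≡⟨ lookup-zipWith _∧_ j (A x) (⋂[ A ] S) ⟨
    lookup (A x ∩ ⋂[ A ] S) j
      ∎

KWiseEventownOn-antitone : ∀ {m n k} (A : Fin m → Subset n) {T T′} →
                           T′ ⊆ T → KWiseEventownOn k A T → KWiseEventownOn k A T′
KWiseEventownOn-antitone A T′⊆T T-even S S⊆T′ = T-even S (T′⊆T ∘ S⊆T′)

StrongKWiseEventownOn-suc : ∀ {m n k} (A : Fin m → Subset n) {T} →
                            StrongKWiseEventownOn k A T → KWiseEventownOn (suc k) A T →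
                            StrongKWiseEventownOn (suc k) A T
StrongKWiseEventownOn-suc A strong T-even k′ 1≤k′ k′≤1+k with m≤n⇒m<n∨m≡n k′≤1+k
... | inj₁ k′<1+k = strong k′ 1≤k′ (≤-pred k′<1+k)
... | inj₂ refl   = T-even

module _ {m n} (A : Fin m → Subset n) where

  ·-⋂-odd : ∀ {x S} → x ∈ S → ¬ 2 ∣ ∣ ⋂[ A ] S ∣ → A x · ⋂[ A ] S ≡ true
  ·-⋂-odd {x} {S} x∈S ¬2∣ = begin
    A x · ⋂[ A ] S                  ≡⟨ cong parity (⋂-⁅x⁆∪ A x S) ⟨
    parity (⋂[ A ] (⁅ x ⁆ ∪ S))     ≡⟨ cong (λ S′ → parity (⋂[ A ] S′)) (x∈p⇒⁅x⁆∪p≡p x∈S) ⟩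
    parity (⋂[ A ] S)               ≡⟨ parity≡odd∣∣ (⋂[ A ] S) ⟩
    odd ∣ ⋂[ A ] S ∣                ≡⟨ ¬2∣⇒odd≡true _ ¬2∣ ⟩
    true                            ∎
    where open ≡-Reasoning

  ·-⋂-even : ∀ x S → 2 ∣ ∣ ⋂[ A ] (⁅ x ⁆ ∪ S) ∣ → A x · ⋂[ A ] S ≡ false
  ·-⋂-even x S even = begin
    A x · ⋂[ A ] S                  ≡⟨ cong parity (⋂-⁅x⁆∪ A x S) ⟨
    parity (⋂[ A ] (⁅ x ⁆ ∪ S))     ≡⟨ parity≡odd∣∣ (⋂[ A ] (⁅ x ⁆ ∪ S)) ⟩
    odd ∣ ⋂[ A ] (⁅ x ⁆ ∪ S) ∣      ≡⟨ 2∣⇒odd≡false _ even ⟩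
    false                           ∎
    where open ≡-Reasoning

  module Pruning (k : ℕ) (T : Subset m) (T-even : KWiseEventownOn (suc (suc k)) A T) where

    Orthogonal : Subset m → List (Vec Bool n × Vec Bool n) → Set
    Orthogonal U L = ∀ S → S ⊆ U → ∣ S ∣ ≡ suc k → All (_⟂ ⋂[ A ] S) L

    OddWitness : Subset m → Subset m → Set
    OddWitness U S = S ⊆ U × ∣ S ∣ ≡ suc k × ¬ 2 ∣ ∣ ⋂[ A ] S ∣

    oddWitness? : ∀ U → Dec (∃ (OddWitness U))
    oddWitness? U = anySubset? λ S → S ⊆? U ×-dec ∣ S ∣ ≟ suc k ×-dec ¬? (2 ∣? ∣ ⋂[ A ] S ∣)

    orthogonal-remove : ∀ {U x S L} → U ⊆ T → x ∈ U → Orthogonal U L →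
                        Orthogonal (U - x) ((A x , ⋂[ A ] S) ∷ L)
    orthogonal-remove {U} {x} U⊆T x∈U orth S′ S′⊆U-x ∣S′∣≡1+k =
      ·-⋂-even x S′ (T-even (⁅ x ⁆ ∪ S′) x∪S′⊆T ∣x∪S′∣≡2+k) ∷ orth S′ S′⊆U ∣S′∣≡1+k
      where
      S′⊆U : S′ ⊆ U
      S′⊆U = p─q⊆p U ⁅ x ⁆ ∘ S′⊆U-x
      x∪S′⊆T : ⁅ x ⁆ ∪ S′ ⊆ T
      x∪S′⊆T = ⁅x⁆∪p⊆q (U⊆T x∈U) (U⊆T ∘ S′⊆U)
      ∣x∪S′∣≡2+k : ∣ ⁅ x ⁆ ∪ S′ ∣ ≡ suc (suc k)
      ∣x∪S′∣≡2+k = trans (x∉p⇒∣⁅x⁆∪p∣≡1+∣p∣ x S′ (x∉p-x x U ∘ S′⊆U-x)) (cong suc ∣S′∣≡1+k)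

    Pruned : Subset m → ℕ → Set
    Pruned U l = Σ (Subset m) λ T′ → T′ ⊆ U × ∣ U ∣ + l ≤ ∣ T′ ∣ + n × KWiseEventownOn (suc k) A T′

    pruneFrom : ∀ U → Acc _<_ ∣ U ∣ → U ⊆ T →
                ∀ {L} → Triangular L → Orthogonal U L → Pruned U (length L)
    pruneFrom U (acc rs) U⊆T {L} tri orth with oddWitness? U
    ... | no ∄odd = U , id , +-monoʳ-≤ ∣ U ∣ (triangular-length≤ tri) , U-even
      where
      U-even : KWiseEventownOn (suc k) A U
      U-even S S⊆U ∣S∣≡1+k = decidable-stable (2 ∣? _) λ ¬2∣ → ∄odd (S , S⊆U , ∣S∣≡1+k , ¬2∣)
    ... | yes (S , S⊆U , ∣S∣≡1+k , ¬2∣) =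
      let x , x∈S = nonempty-if-∣p∣≡suc S ∣S∣≡1+k
          x∈U = S⊆U x∈S
          U-x⊆U = p─q⊆p U ⁅ x ⁆
          T′ , T′⊆U-x , bound , T′-even =
            pruneFrom (U - x) (rs (x∈p⇒∣p-x∣<∣p∣ x∈U)) (U⊆T ∘ U-x⊆U)
                      (extend (·-⋂-odd x∈S ¬2∣) (orth S S⊆U ∣S∣≡1+k) tri)
                      (orthogonal-remove {S = S} U⊆T x∈U orth)
          size : ∣ U - x ∣ + suc (length L) ≡ ∣ U ∣ + length L
          size = trans (+-suc ∣ U - x ∣ (length L))
                       (cong (_+ length L) (sym (x∈p⇒∣p∣≡1+∣p-x∣ x∈U)))
      in T′ , U-x⊆U ∘ T′⊆U-x , subst (_≤ ∣ T′ ∣ + n) size bound , T′-even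

    prune : Σ (Subset m) λ T′ → T′ ⊆ T × ∣ T ∣ ≤ ∣ T′ ∣ + n × KWiseEventownOn (suc k) A T′
    prune =
      let T′ , T′⊆T , bound , T′-even = pruneFrom T (<-wellFounded ∣ T ∣) id [] (λ _ _ _ → [])
      in T′ , T′⊆T , subst (_≤ ∣ T′ ∣ + n) (+-identityʳ ∣ T ∣) bound , T′-even

  strengthen : ∀ k T → KWiseEventownOn (suc k) A T →
               Σ (Subset m) λ T′ →
                 T′ ⊆ T × ∣ T ∣ ≤ ∣ T′ ∣ + k * n × StrongKWiseEventownOn (suc k) A T′
  strengthen zero T T-even =
    T , id , m≤m+n ∣ T ∣ 0 , StrongKWiseEventownOn-suc A (λ { _ (s≤s _) () }) T-even
  strengthen (suc k) T T-even
    with T₁ , T₁⊆T , T≤T₁+n , T₁-even ← Pruning.prune k T T-even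
    with T′ , T′⊆T₁ , T₁≤T′+kn , T′-strong ← strengthen k T₁ T₁-even =
    T′ , T₁⊆T ∘ T′⊆T₁ , bound ,
    StrongKWiseEventownOn-suc A T′-strong (KWiseEventownOn-antitone A (T₁⊆T ∘ T′⊆T₁) T-even)
    where
    open ≤-Reasoning
    bound : ∣ T ∣ ≤ ∣ T′ ∣ + (n + k * n)
    bound = begin
      ∣ T ∣                 ≤⟨ T≤T₁+n ⟩
      ∣ T₁ ∣ + n            ≤⟨ +-monoˡ-≤ n T₁≤T′+kn ⟩
      ∣ T′ ∣ + k * n + n    ≡⟨ +-assoc ∣ T′ ∣ (k * n) n ⟩
      ∣ T′ ∣ + (k * n + n)  ≡⟨ cong (∣ T′ ∣ +_) (+-comm (k * n) n) ⟩
      ∣ T′ ∣ + (n + k * n)  ∎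

-- The A_i need not be distinct.
lemma3p4 : (n m k : ℕ) → 1 ≤ k → (A : Fin m → Subset n) → Injective _≡_ _≡_ A →
    KWiseEventown k A →
    Σ (Subset m) λ T → (m ≤ ∣ T ∣ + (k ∸ 1) * n) × StrongKWiseEventownOn k A T
lemma3p4 n m (suc k) _ A _ A-even =
  let T , _ , bound , T-strong = strengthen A k ⊤ (λ S _ → A-even S)
  in T , subst (_≤ ∣ T ∣ + k * n) (∣⊤∣≡n m) bound , T-strong
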